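{- Let $\Sigma=(A,B)$ be a signature, $\varepsilon=(E,V,l,r)$ a system of equations over it, and $(QW,\mathrm{qwintro},\mathrm{qwequate},\mathrm{qwrec},\mathrm{qwrechom},\mathrm{qwuniq})$ a QW-type for $(\Sigma,\varepsilon)$. Let $P:QW\to\mathcal{U}$ and $p:\prod_{a:A}\prod_{b:B\,a\to QW}\big(\prod_{x:B\,a}P(b\,x)\big)\to P(\mathrm{qwintro}(a,b))$, and suppose given $$p_{\mathrm{resp}}:\prod_{e:E}\ \prod_{\rho:V\,e\to\sum_{x:QW}P\,x}\ \mathrm{lift}_{P,V\,e}\,p\,\rho\,(l\,e)\;\cong\;\mathrm{lift}_{P,V\,e}\,p\,\rho\,(r\,e).$$ Then there exist $\mathrm{qwelim}:\prod_{x:QW}P\,x$ and a proof $\mathrm{qwcomp}$ that for all $a:A$ and $b:B\,a\to QW$, $\mathrm{qwelim}(\mathrm{qwintro}(a,b))=p\,a\,b\,(\mathrm{qwelim}\circ b)$.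
   Context: We work in extensional type theory (internal language of a topos with universes $\mathcal{U}$, impredicative $\mathrm{Prop}$, function extensionality). $x\cong y$ denotes heterogeneous identity: for $x:X$, $y:Y$ it is inhabited iff $X\equiv Y$ and $x\equiv y$. A signature is $\Sigma=(A,B)$ with $A:\mathcal{U}$, $B:A\to\mathcal{U}$; $S_\Sigma(X):=\sum_{a:A}(B\,a\to X)$, $S_\Sigma f(a,b):=(a,f\circ b)$. An $S_\Sigma$-algebra is $(X,\alpha:S_\Sigma X\to X)$; $h:X\to X'$ is a homomorphism $(X,\alpha)\to(X',\alpha')$ ($\mathrm{isHom}\,h$) if $\alpha'(a,h\circ b)=h(\alpha(a,b))$ for all $a,b$. For $V:\mathcal{U}$, $T_\Sigma V$ is the inductive type with constructors $\eta:V\to T_\Sigma V$ and $\sigma:S_\Sigma(T_\Sigma V)\to T_\Sigma V$; for an algebra $(X,\alpha)$ and $f:V\to X$, $\eta\,x\ggg f:=f\,x$ and $\sigma(a,b)\ggg f:=\alpha(a,\lambda x.\,b\,x\ggg f)$. A system of equations is $\varepsilon=(E,V,l,r)$ with $E:\mathcal{U}$, $V:E\to\mathcal{U}$, $l,r:\prod_{e:E}T_\Sigma(V\,e)$; $\mathrm{Sat}_{\alpha,\varepsilon}(X)$ is the proposition $\forall(e:E).\forall(\rho:V\,e\to X).\,(l\,e\ggg\rho)=(r\,e\ggg\rho)$. A QW-type for $(\Sigma,\varepsilon)$ consists of $QW:\mathcal{U}$, $\mathrm{qwintro}:S_\Sigma(QW)\to QW$, $\mathrm{qwequate}:\mathrm{Sat}_{\mathrm{qwintro},\varepsilon}(QW)$,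 and for every $X:\mathcal{U}$, $\alpha:S_\Sigma X\to X$ and $s:\mathrm{Sat}_{\alpha,\varepsilon}(X)$ a function $\mathrm{qwrec}\,X\,\alpha\,s:QW\to X$ with a proof $\mathrm{qwrechom}$ that it is a homomorphism from $(QW,\mathrm{qwintro})$ to $(X,\alpha)$, and a proof $\mathrm{qwuniq}$ that every homomorphism $f:QW\to X$ from $(QW,\mathrm{qwintro})$ to $(X,\alpha)$ equals $\mathrm{qwrec}\,X\,\alpha\,s$. For $P,p$ as in the claim, $X:\mathcal{U}$ and $\rho:X\to\sum_{x:QW}P\,x$, the function $\mathrm{lift}_{P,X}\,p\,\rho:\prod_{t:T_\Sigma X}P(t\ggg(\pi_1\circ\rho))$ (with $\ggg$ taken w.r.t. the algebra $\mathrm{qwintro}$) is defined by recursion on $t$: $\mathrm{lift}_{P,X}\,p\,\rho\,(\eta\,x):=\pi_2(\rho\,x)$ and $\mathrm{lift}_{P,X}\,p\,\rho\,(\sigma(a,b)):=p\,a\,(\lambda x.\,b\,x\ggg(\pi_1\circ\rho))\,((\mathrm{lift}_{P,X}\,p\,\rho)\circ b)$. -}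

module Defs where

open import Level using (Level; _⊔_) renaming (suc to lsuc)
open import Data.Product using (Σ; _,_; proj₁; proj₂)
open import Function using (_∘_)
open import Relation.Binary.PropositionalEquality using (_≡_)
open import Relation.Binary.HeterogeneousEquality using (_≅_)

record Sig (ℓ : Level) : Set (lsuc ℓ) where
  constructor sig
  field
    A : Set ℓ
    B : A → Set ℓ
open Sig public

S : ∀ {ℓ} → Sig ℓ → Set ℓ → Set ℓ
S Σs X = Σ (A Σs) (λ a → B Σs a → X)

Smap : ∀ {ℓ} (Σs : Sig ℓ) {X Y : Set ℓ} → (X → Y) → S Σs X → S Σs Y
Smap Σs f (a , b) = a , f ∘ b

isHom : ∀ {ℓ} (Σs : Sig ℓ) {X X' : Set ℓ} (α : S Σs X → X) (α' : S Σs X' → X')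
        → (X → X') → Set ℓ
isHom Σs α α' h = ∀ a b → α' (a , h ∘ b) ≡ h (α (a , b))

data T {ℓ} (Σs : Sig ℓ) (V : Set ℓ) : Set ℓ where
  η : V → T Σs V
  σ : S Σs (T Σs V) → T Σs V

bind : ∀ {ℓ} {Σs : Sig ℓ} {V X : Set ℓ} (α : S Σs X → X)
       → T Σs V → (V → X) → X
bind α (η x) f = f x
bind α (σ (a , b)) f = α (a , λ x → bind α (b x) f)

record Eqs {ℓ} (Σs : Sig ℓ) : Set (lsuc ℓ) where
  constructor eqs
  field
    E : Set ℓ
    V : E → Set ℓ
    l : (e : E) → T Σs (V e)
    r : (e : E) → T Σs (V e)
open Eqs public

Sat : ∀ {ℓ} {Σs : Sig ℓ} (ε : Eqs Σs) {X : Set ℓ} (α : S Σs X → X) → Set ℓ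
Sat ε {X} α = (e : E ε) (ρ : V ε e → X) → bind α (l ε e) ρ ≡ bind α (r ε e) ρ

record QWtype {ℓ} (Σs : Sig ℓ) (ε : Eqs Σs) : Set (lsuc ℓ) where
  field
    QW       : Set ℓ
    qwintro  : S Σs QW → QW
    qwequate : Sat ε qwintro
    qwrec    : (X : Set ℓ) (α : S Σs X → X) (s : Sat ε α) → QW → X
    qwrechom : (X : Set ℓ) (α : S Σs X → X) (s : Sat ε α)
               → isHom Σs qwintro α (qwrec X α s)
    qwuniq   : (X : Set ℓ) (α : S Σs X → X) (s : Sat ε α) (f : QW → X)
               → isHom Σs qwintro α f → f ≡ qwrec X α s

module _ {ℓ} {Σs : Sig ℓ} {ε : Eqs Σs} (Q : QWtype Σs ε) where
  open QWtype Q

  Motive : (P : QW → Set ℓ) → Set ℓ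
  Motive P = (a : A Σs) (b : B Σs a → QW) → ((x : B Σs a) → P (b x)) → P (qwintro (a , b))

  lift : (P : QW → Set ℓ) (X : Set ℓ) (p : Motive P) (ρ : X → Σ QW P)
         → (t : T Σs X) → P (bind qwintro t (proj₁ ∘ ρ))
  lift P X p ρ (η x) = proj₂ (ρ x)
  lift P X p ρ (σ (a , b)) =
    p a (λ x → bind qwintro (b x) (proj₁ ∘ ρ)) (λ x → lift P X p ρ (b x))

-- The motive is turned into an algebra on the total space Σ QW P. The
-- hypothesis presp says exactly that this algebra satisfies the equations, so
-- recursion yields a homomorphism h : QW → Σ QW P. Then proj₁ ∘ h is an
-- endomorphism of the initial algebra, hence the identity, so h is a section of
-- proj₁ and its second component is the eliminator; the computation rule is the
-- homomorphism property of h.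
module Submission where

open import Defs
open import Level using (Level)
open import Data.Product using (Σ; _,_; proj₁; proj₂)
open import Function using (_∘_; id)
open import Relation.Binary.PropositionalEquality
  using (_≡_; refl; sym; trans; cong; cong-app; subst; module ≡-Reasoning)
open import Relation.Binary.HeterogeneousEquality as H using (_≅_; ≅-to-≡; ≡-to-≅)
open import Axiom.Extensionality.Propositional using (Extensionality)

module _ {ℓ : Level} {X : Set ℓ} {P : X → Set ℓ} where

  Π-≅ : Extensionality ℓ ℓ → {I : Set ℓ} {b b′ : I → X} → b ≡ b′
      → {f : (i : I) → P (b i)} {g : (i : I) → P (b′ i)}
      → ((i : I) → f i ≅ g i) → f ≅ g
  Π-≅ fe refl f≅g = ≡-to-≅ (fe (λ i → ≅-to-≡ (f≅g i)))

  Σ-≡ : {x y : X} {u : P x} {v : P y} → x ≡ y → u ≅ v → _≡_ {A = Σ X P} (x , u) (y , v)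
  Σ-≡ refl H.refl = refl

  module _ (h : X → Σ X P) (proj₁∘h≡id : proj₁ ∘ h ≡ id) where

    section⇒Π : (x : X) → P x
    section⇒Π x = subst P (cong-app proj₁∘h≡id x) (proj₂ (h x))

    section⇒Π-≅ : (x : X) → section⇒Π x ≅ proj₂ (h x)
    section⇒Π-≅ x = H.≡-subst-removable P (cong-app proj₁∘h≡id x) (proj₂ (h x))

module _ {ℓ : Level} {Σs : Sig ℓ} {ε : Eqs Σs} (Q : QWtype Σs ε) where
  open QWtype Q

  endo-hom⇒id : (f : QW → QW) → isHom Σs qwintro qwintro f → f ≡ id
  endo-hom⇒id f f-hom =
    trans (qwuniq QW qwintro qwequate f f-hom)
          (sym (qwuniq QW qwintro qwequate id (λ _ _ → refl)))

  module _ (fe : Extensionality ℓ ℓ) (P : QW → Set ℓ) (p : Motive Q P) where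

    total-alg : S Σs (Σ QW P) → Σ QW P
    total-alg (a , b) = qwintro (a , proj₁ ∘ b) , p a (proj₁ ∘ b) (proj₂ ∘ b)

    bind-total-alg : {X : Set ℓ} (ρ : X → Σ QW P) (t : T Σs X)
      → bind total-alg t ρ ≡ (bind qwintro t (proj₁ ∘ ρ) , lift Q P X p ρ t)
    bind-total-alg ρ (η x) = refl
    bind-total-alg ρ (σ (a , b)) =
      cong (λ c → total-alg (a , c)) (fe (λ x → bind-total-alg ρ (b x)))

    module _ (presp : (e : E ε) (ρ : V ε e → Σ QW P)
               → lift Q P (V ε e) p ρ (l ε e) ≅ lift Q P (V ε e) p ρ (r ε e)) where

      total-alg-sat : Sat ε total-alg
      total-alg-sat e ρ = begin
        bind total-alg (l ε e) ρ
          ≡⟨ bind-total-alg ρ (l ε e) ⟩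
        (bind qwintro (l ε e) (proj₁ ∘ ρ) , lift Q P (V ε e) p ρ (l ε e))
          ≡⟨ Σ-≡ (qwequate e (proj₁ ∘ ρ)) (presp e ρ) ⟩
        (bind qwintro (r ε e) (proj₁ ∘ ρ) , lift Q P (V ε e) p ρ (r ε e))
          ≡⟨ sym (bind-total-alg ρ (r ε e)) ⟩
        bind total-alg (r ε e) ρ ∎
        where open ≡-Reasoning

      total-rec : QW → Σ QW P
      total-rec = qwrec (Σ QW P) total-alg total-alg-sat

      total-rec-hom : isHom Σs qwintro total-alg total-rec
      total-rec-hom = qwrechom (Σ QW P) total-alg total-alg-sat

      proj₁∘total-rec≡id : proj₁ ∘ total-rec ≡ id
      proj₁∘total-rec≡id =
        endo-hom⇒id (proj₁ ∘ total-rec) (λ a b → cong proj₁ (total-rec-hom a b))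

      qwelim : (x : QW) → P x
      qwelim = section⇒Π total-rec proj₁∘total-rec≡id

      qwcomp : (a : A Σs) (b : B Σs a → QW) → qwelim (qwintro (a , b)) ≡ p a b (qwelim ∘ b)
      qwcomp a b = ≅-to-≡ (begin
        qwelim (qwintro (a , b))
          ≅⟨ section⇒Π-≅ total-rec proj₁∘total-rec≡id (qwintro (a , b)) ⟩
        proj₂ (total-rec (qwintro (a , b)))
          ≅⟨ H.cong proj₂ (≡-to-≅ (sym (total-rec-hom a b))) ⟩
        p a (proj₁ ∘ total-rec ∘ b) (proj₂ ∘ total-rec ∘ b)
          ≅⟨ H.cong₂ (p a) (≡-to-≅ (cong (_∘ b) proj₁∘total-rec≡id))
                 (Π-≅ {P = P} fe (cong (_∘ b) proj₁∘total-rec≡id)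
                   (λ x → H.sym (section⇒Π-≅ total-rec proj₁∘total-rec≡id (b x)))) ⟩
        p a b (qwelim ∘ b) ∎)
        where open H.≅-Reasoning

proposition3p4 : {ℓ : Level} → Extensionality ℓ ℓ
    → (Σs : Sig ℓ) (ε : Eqs Σs) (Q : QWtype Σs ε)
    → (P : QWtype.QW Q → Set ℓ) (p : Motive Q P)
    → (presp : (e : E ε) (ρ : V ε e → Σ (QWtype.QW Q) P)
    → lift Q P (V ε e) p ρ (l ε e) ≅ lift Q P (V ε e) p ρ (r ε e))
    → Σ ((x : QWtype.QW Q) → P x) (λ qwelim →
    (a : A Σs) (b : B Σs a → QWtype.QW Q)
    → qwelim (QWtype.qwintro Q (a , b)) ≡ p a b (qwelim ∘ b))
proposition3p4 fe Σs ε Q P p presp = qwelim Q fe P p presp , qwcomp Q fe P p presp
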